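{- Let $M=\langle W,\emptyset,\preceq,\equiv,V\rangle$ be an $\mathsf{IS5}$-model, let $\varphi$ be a constructive $\mu$-formula and $\triangle\in\{\Box,\Diamond\}$. If $w\,(\preceq;\equiv)\,w'$, then $M,w\models\triangle\varphi$ implies $M,w'\models\triangle\varphi$.
   Context: Constructive $\mu$-formulas: $\varphi ::= P \mid X \mid \bot \mid \top \mid \neg\varphi \mid \varphi\land\varphi \mid \varphi\lor\varphi \mid \varphi\to\varphi \mid \Box\varphi \mid \Diamond\varphi \mid \mu X.\varphi \mid \nu X.\varphi$ (fixed points formed only when $X$ is positive in the body in the usual syntactic sense); free variables are treated as proposition symbols. A $\mathsf{CK}$-model $\langle W,W^\bot,\preceq,R,V\rangle$: $\preceq$ a preorder, $R$ a relation on $W$, $V$ upward closed under $\preceq$ with $W^\bot\subseteq V(P)$, $W^\bot$ closed under $\preceq$- and $R$-successors. Semantics: $w\in\|\Box\varphi\|$ iff $u\in\|\varphi\|$ whenever $w\preceq vRu$; $w\in\|\Diamond\varphi\|$ iff for every $v\succeq w$ there is $u$ with $vRu$ and $u\in\|\varphi\|$ (other connectives: $\|\bot\|=W^\bot$, $\|\top\|=W$, $\land/\lor$ intersection/union, $\to$ and $\neg$ via all $\preceq$-successors, $\mu/\nu$ least/greatest fixed points); $M,w\models\varphi$ iff $w\in\|\varphi\|^M$. An $\mathsf{IS5}$-model is a $\mathsf{CK}$-model with $W^\bot=\emptyset$ whose modal relation $\equiv$ is an equivalence relation, forward confluent ($w\equiv v$, $w\preceq w'$ imply $v\preceq v'\equiv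 w'$ for some $v'$) and backward confluent ($w\equiv v\preceq v'$ implies $w\preceq w'\equiv v'$ for some $w'$). $w\,(\preceq;\equiv)\,u$ iff $w\preceq v\equiv u$ for some $v$. -}

module Defs where

open import Level using (Level; 0ℓ; lift) renaming (suc to lsuc)
open import Data.Nat using (ℕ; _≟_)
open import Data.Sum using (_⊎_; inj₁; inj₂)
open import Data.Product using (Σ; _×_; _,_; ∃)
open import Data.Empty using (⊥)
open import Data.Unit using (⊤)
open import Relation.Nullary using (¬_; yes; no)
open import Relation.Binary.PropositionalEquality using (_≡_)

PropSym : Set
PropSym = ℕ

FVar : Set
FVar = ℕ

data Formula : Set where
  prop : PropSym → Formula
  var  : FVar → Formula
  ⊥'   : Formula
  ⊤'   : Formula
  ¬'_  : Formula → Formula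
  _∧'_ : Formula → Formula → Formula
  _∨'_ : Formula → Formula → Formula
  _⇒'_ : Formula → Formula → Formula
  □'_  : Formula → Formula
  ◇'_  : Formula → Formula
  μ'   : FVar → Formula → Formula
  ν'   : FVar → Formula → Formula

mutual
  data Pos (X : FVar) : Formula → Set where
    pos-prop : ∀ P → Pos X (prop P)
    pos-var  : ∀ Y → Pos X (var Y)
    pos-⊥    : Pos X ⊥'
    pos-⊤    : Pos X ⊤'
    pos-¬    : ∀ {φ} → Neg X φ → Pos X (¬' φ)
    pos-∧    : ∀ {φ ψ} → Pos X φ → Pos X ψ → Pos X (φ ∧' ψ)
    pos-∨    : ∀ {φ ψ} → Pos X φ → Pos X ψ → Pos X (φ ∨' ψ)
    pos-⇒    : ∀ {φ ψ} → Neg X φ → Pos X ψ → Pos X (φ ⇒' ψ)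
    pos-□    : ∀ {φ} → Pos X φ → Pos X (□' φ)
    pos-◇    : ∀ {φ} → Pos X φ → Pos X (◇' φ)
    pos-μ-bound : ∀ {φ} → Pos X (μ' X φ)
    pos-ν-bound : ∀ {φ} → Pos X (ν' X φ)
    pos-μ    : ∀ {Y φ} → ¬ (X ≡ Y) → Pos X φ → Pos X (μ' Y φ)
    pos-ν    : ∀ {Y φ} → ¬ (X ≡ Y) → Pos X φ → Pos X (ν' Y φ)

  data Neg (X : FVar) : Formula → Set where
    neg-prop : ∀ P → Neg X (prop P)
    neg-var  : ∀ Y → ¬ (X ≡ Y) → Neg X (var Y)
    neg-⊥    : Neg X ⊥'
    neg-⊤    : Neg X ⊤'
    neg-¬    : ∀ {φ} → Pos X φ → Neg X (¬' φ)
    neg-∧    : ∀ {φ ψ} → Neg X φ → Neg X ψ → Neg X (φ ∧' ψ)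
    neg-∨    : ∀ {φ ψ} → Neg X φ → Neg X ψ → Neg X (φ ∨' ψ)
    neg-⇒    : ∀ {φ ψ} → Pos X φ → Neg X ψ → Neg X (φ ⇒' ψ)
    neg-□    : ∀ {φ} → Neg X φ → Neg X (□' φ)
    neg-◇    : ∀ {φ} → Neg X φ → Neg X (◇' φ)
    neg-μ-bound : ∀ {φ} → Neg X (μ' X φ)
    neg-ν-bound : ∀ {φ} → Neg X (ν' X φ)
    neg-μ    : ∀ {Y φ} → ¬ (X ≡ Y) → Neg X φ → Neg X (μ' Y φ)
    neg-ν    : ∀ {Y φ} → ¬ (X ≡ Y) → Neg X φ → Neg X (ν' Y φ)

data WF : Formula → Set where
  wf-prop : ∀ P → WF (prop P)
  wf-var  : ∀ X → WF (var X)
  wf-⊥    : WF ⊥'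
  wf-⊤    : WF ⊤'
  wf-¬    : ∀ {φ} → WF φ → WF (¬' φ)
  wf-∧    : ∀ {φ ψ} → WF φ → WF ψ → WF (φ ∧' ψ)
  wf-∨    : ∀ {φ ψ} → WF φ → WF ψ → WF (φ ∨' ψ)
  wf-⇒    : ∀ {φ ψ} → WF φ → WF ψ → WF (φ ⇒' ψ)
  wf-□    : ∀ {φ} → WF φ → WF (□' φ)
  wf-◇    : ∀ {φ} → WF φ → WF (◇' φ)
  wf-μ    : ∀ {X φ} → Pos X φ → WF φ → WF (μ' X φ)
  wf-ν    : ∀ {X φ} → Pos X φ → WF φ → WF (ν' X φ)

-- CK-models.  Free variables are treated as proposition symbols, so
-- the valuation assigns a set to every symbol in  PropSym ⊎ FVar
-- (inj₁ P : proposition symbol, inj₂ X : free variable).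

Symbol : Set
Symbol = PropSym ⊎ FVar

record CKModel : Set₁ where
  field
    W     : Set
    W⊥    : W → Set
    _≼_   : W → W → Set
    R     : W → W → Set
    V     : Symbol → W → Set
    ≼-refl  : ∀ {w} → w ≼ w
    ≼-trans : ∀ {u v w} → u ≼ v → v ≼ w → u ≼ w
    V-up    : ∀ s {w v} → w ≼ v → V s w → V s v
    W⊥⊆V    : ∀ s {w} → W⊥ w → V s w
    W⊥-≼    : ∀ {w v} → W⊥ w → w ≼ v → W⊥ v
    W⊥-R    : ∀ {w v} → W⊥ w → R w v → W⊥ v

module Semantics (M : CKModel) where
  open CKModel M

  Pred : Set₁
  Pred = W → Set

  Env : Set₁
  Env = FVar → Pred

  _[_↦_] : Env → FVar → Pred → Env
  (ρ [ X ↦ S ]) Y with X ≟ Y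
  ... | yes _ = S
  ... | no  _ = ρ Y

  -- ‖φ‖ρ (valued in Set₁ because fixed points quantify over subsets of W):
  -- μ: intersection of all pre-fixed points; ν: union of all post-fixed points.
  ⟦_⟧ : Formula → Env → W → Set₁
  ⟦ prop P ⟧ ρ w = Level.Lift (lsuc 0ℓ) (V (inj₁ P) w)
  ⟦ var X ⟧ ρ w = Level.Lift (lsuc 0ℓ) (ρ X w)
  ⟦ ⊥' ⟧ ρ w = Level.Lift (lsuc 0ℓ) (W⊥ w)
  ⟦ ⊤' ⟧ ρ w = Level.Lift (lsuc 0ℓ) ⊤
  ⟦ ¬' φ ⟧ ρ w = ∀ v → w ≼ v → ⟦ φ ⟧ ρ v → Level.Lift (lsuc 0ℓ) (W⊥ v)
  ⟦ φ ∧' ψ ⟧ ρ w = ⟦ φ ⟧ ρ w × ⟦ ψ ⟧ ρ w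
  ⟦ φ ∨' ψ ⟧ ρ w = ⟦ φ ⟧ ρ w ⊎ ⟦ ψ ⟧ ρ w
  ⟦ φ ⇒' ψ ⟧ ρ w = ∀ v → w ≼ v → ⟦ φ ⟧ ρ v → ⟦ ψ ⟧ ρ v
  ⟦ □' φ ⟧ ρ w = ∀ v u → w ≼ v → R v u → ⟦ φ ⟧ ρ u
  ⟦ ◇' φ ⟧ ρ w = ∀ v → w ≼ v → Σ W λ u → Level.Lift (lsuc 0ℓ) (R v u) × ⟦ φ ⟧ ρ u
  ⟦ μ' X φ ⟧ ρ w =
    ∀ (S : Pred) → (∀ v → ⟦ φ ⟧ (ρ [ X ↦ S ]) v → Level.Lift (lsuc 0ℓ) (S v)) → S w
  ⟦ ν' X φ ⟧ ρ w =
    Σ Pred λ S → (∀ v → S v → ⟦ φ ⟧ (ρ [ X ↦ S ]) v) × S w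

  ρ₀ : Env
  ρ₀ X = V (inj₂ X)

  _⊨_ : W → Formula → Set₁
  w ⊨ φ = ⟦ φ ⟧ ρ₀ w

record IS5Model : Set₁ where
  field
    ck : CKModel
  open CKModel ck public
  field
    W⊥-empty   : ∀ w → ¬ W⊥ w
    R-refl     : ∀ {w} → R w w
    R-sym      : ∀ {w v} → R w v → R v w
    R-trans    : ∀ {u v w} → R u v → R v w → R u w
    forward-confluent  : ∀ {w v w'} → R w v → w ≼ w' → Σ W λ v' → v ≼ v' × R w' v'
    backward-confluent : ∀ {w v v'} → R w v → v ≼ v' → Σ W λ w' → w ≼ w' × R w' v'

_≼∘≡_ : {M : IS5Model} → IS5Model.W M → IS5Model.W M → Set
_≼∘≡_ {M} w u = Σ W λ v → w ≼ v × R v u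
  where open IS5Model M

data Modality : Set where
  box dia : Modality

apply : Modality → Formula → Formula
apply box φ = □' φ
apply dia φ = ◇' φ

module Submission where

open import Defs
open import Data.Product using (Σ; _×_; _,_)
open import Level using (lift)

-- Backward confluence lets a ≼-step taken after w (≼;≡) w' be performed
-- before the ≡-step instead; a □- or ◇-formula at w' then only talks about
-- worlds ≡-related to a ≼-successor of w, where the hypothesis at w applies
-- since ≡ is an equivalence relation.

module _ (M : IS5Model) where
  open IS5Model M
  open Semantics ck

  ≼∘≡-≼-trans : ∀ {w w' v} → _≼∘≡_ {M} w w' → w' ≼ v → _≼∘≡_ {M} w v
  ≼∘≡-≼-trans (a , w≼a , aRw') w'≼v with backward-confluent aRw' w'≼v
  ... | a' , a≼a' , a'Rv = a' , ≼-trans w≼a a≼a' , a'Rv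

  □-≼∘≡-stable : ∀ φ ρ {w w'} → _≼∘≡_ {M} w w' → ⟦ □' φ ⟧ ρ w → ⟦ □' φ ⟧ ρ w'
  □-≼∘≡-stable φ ρ w≼≡w' □φ v u w'≼v vRu with ≼∘≡-≼-trans w≼≡w' w'≼v
  ... | a , w≼a , aRv = □φ a u w≼a (R-trans aRv vRu)

  ◇-≼∘≡-stable : ∀ φ ρ {w w'} → _≼∘≡_ {M} w w' → ⟦ ◇' φ ⟧ ρ w → ⟦ ◇' φ ⟧ ρ w'
  ◇-≼∘≡-stable φ ρ w≼≡w' ◇φ v w'≼v with ≼∘≡-≼-trans w≼≡w' w'≼v
  ... | a , w≼a , aRv with ◇φ a w≼a
  ...   | u , lift aRu , φu = u , lift (R-trans (R-sym aRv) aRu) , φu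

mainTheorem10 : (M : IS5Model) (φ : Formula) → WF φ → (△ : Modality) →
    (w w' : IS5Model.W M) → _≼∘≡_ {M} w w' →
    Semantics._⊨_ (IS5Model.ck M) w (apply △ φ) →
    Semantics._⊨_ (IS5Model.ck M) w' (apply △ φ)
mainTheorem10 M φ _ box w w' = □-≼∘≡-stable M φ (Semantics.ρ₀ (IS5Model.ck M))
mainTheorem10 M φ _ dia w w' = ◇-≼∘≡-stable M φ (Semantics.ρ₀ (IS5Model.ck M))
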